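{- Let $A=(A,+,\vee,\wedge,\ast,0)$ be an AL-monoid and let $a,b,c\in A$ be pairwise distinct. The following are equivalent: (i) the triangle $\triangle(a,b,c)$ has fixty, i.e. $a\ast b=c$, $b\ast c=a$ and $c\ast a=b$; (ii) $a\vee b=b\vee c=c\vee a$ and $a\wedge b\wedge c=0$; (iii) the triangle $\triangle(a\ast b,\,b\ast c,\,c\ast a)$ has fixty, i.e. $(a\ast b)\ast(b\ast c)=c\ast a$, $(b\ast c)\ast(c\ast a)=a\ast b$ and $(c\ast a)\ast(a\ast b)=b\ast c$, and the set $\{0,a,b,c\}$ is a subgeometry of $A$.
   Context: An AL-monoid (autometrized lattice ordered monoid) is an algebra $(A,+,\vee,\wedge,\ast,0)$ of type $(2,2,2,2,0)$ such that: (1) $(A,+,\vee,\wedge,0)$ is a commutative lattice ordered monoid, i.e. $(A,+,0)$ is a commutative monoid with identity $0$, $(A,\vee,\wedge)$ is a lattice with induced order $\leq$, and $a+(b\vee c)=(a+b)\vee(a+c)$, $a+(b\wedge c)=(a+b)\wedge(a+c)$; (2) $a\ast(a\wedge b)+b=a\vee b$ for all $a,b$; (3) for each $a\in A$ the maps $x\mapsto a+x$, $x\mapsto a\vee x$, $x\mapsto a\wedge x$, $x\mapsto a\ast x$ are contractions with respect to $\ast$, i.e. $f(x)\ast f(y)\leq x\ast y$ for all $x,y$; (4) $[a\ast(a\vee b)]\wedge[b\ast(a\vee b)]=0$ for all $a,b$; and $\ast$ is a metric operation: $a\ast b\geq 0$ with equality iff $a=b$, $a\ast b=b\ast a$, and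 $a\ast b\leq a\ast c+c\ast b$ for all $a,b,c$. Any three pairwise distinct elements $a,b,c$ are regarded as the vertices of a triangle $\triangle(a,b,c)$ with sides $a\ast b$, $b\ast c$, $c\ast a$. A subset $S\subseteq A$ is a subgeometry if $x,y\in S$ implies $x\ast y\in S$. -}

module Defs where

open import Level using (Level; suc)
open import Data.Product using (_×_; _,_)
open import Relation.Binary.PropositionalEquality using (_≡_; _≢_)

-- Autometrized lattice ordered monoid (AL-monoid), with equality taken to be
-- propositional equality on the carrier.
record ALMonoid (ℓ : Level) : Set (suc ℓ) where
  infixl 6 _+_
  infixl 7 _∨_ _∧_
  infixl 8 _*_
  infix 4 _≤_
  field
    Carrier : Set ℓ
    _+_ _∨_ _∧_ _*_ : Carrier → Carrier → Carrier
    0# : Carrier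

  _≤_ : Carrier → Carrier → Set ℓ
  x ≤ y = x ∧ y ≡ x

  field
    +-assoc     : ∀ x y z → (x + y) + z ≡ x + (y + z)
    +-comm      : ∀ x y → x + y ≡ y + x
    +-identityˡ : ∀ x → 0# + x ≡ x
    ∨-comm      : ∀ x y → x ∨ y ≡ y ∨ x
    ∨-assoc     : ∀ x y z → (x ∨ y) ∨ z ≡ x ∨ (y ∨ z)
    ∧-comm      : ∀ x y → x ∧ y ≡ y ∧ x
    ∧-assoc     : ∀ x y z → (x ∧ y) ∧ z ≡ x ∧ (y ∧ z)
    ∨-absorbs-∧ : ∀ x y → x ∨ (x ∧ y) ≡ x
    ∧-absorbs-∨ : ∀ x y → x ∧ (x ∨ y) ≡ x
    +-distrib-∨ : ∀ a b c → a + (b ∨ c) ≡ (a + b) ∨ (a + c)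
    +-distrib-∧ : ∀ a b c → a + (b ∧ c) ≡ (a + b) ∧ (a + c)
    ax2 : ∀ a b → a * (a ∧ b) + b ≡ a ∨ b
    contr-+ : ∀ a x y → (a + x) * (a + y) ≤ x * y
    contr-∨ : ∀ a x y → (a ∨ x) * (a ∨ y) ≤ x * y
    contr-∧ : ∀ a x y → (a ∧ x) * (a ∧ y) ≤ x * y
    contr-* : ∀ a x y → (a * x) * (a * y) ≤ x * y
    ax4 : ∀ a b → (a * (a ∨ b)) ∧ (b * (a ∨ b)) ≡ 0#
    *-nonneg : ∀ a b → 0# ≤ a * b
    *-zero⇒≡ : ∀ a b → a * b ≡ 0# → a ≡ b
    *-self   : ∀ a → a * a ≡ 0#
    *-comm   : ∀ a b → a * b ≡ b * a
    *-triangle : ∀ a b c → a * b ≤ a * c + c * b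

  IsSubgeometry : ∀ {p} → (Carrier → Set p) → Set (ℓ Level.⊔ p)
  IsSubgeometry S = ∀ x y → S x → S y → S (x * y)

  Set0abc : Carrier → Carrier → Carrier → Carrier → Set ℓ
  Set0abc a b c x = (x ≡ 0#) ⊎ (x ≡ a) ⊎ (x ≡ b) ⊎ (x ≡ c)
    where open import Data.Sum using (_⊎_)

  HasFixty : Carrier → Carrier → Carrier → Set ℓ
  HasFixty a b c = (a * b ≡ c) × (b * c ≡ a) × (c * a ≡ b)

-- Fixty forces the vertices to be nonnegative, and then a ∗ b ≤ a ∨ b shows that
-- each vertex lies below the join of the other two, so all three pairwise joins
-- coincide; writing m for that join, every vertex is bounded by a sum of two of
-- the distances a ∗ m, b ∗ m, c ∗ m, which are pairwise disjoint by axiom (4),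
-- and this squeezes a ∧ b ∧ c to 0. Conversely, from a common join m and a zero
-- triple meet, a ∗ b ≤ c because a ∨ b ≤ c + (a ∧ b), and c ≤ a ∗ b because
-- c ∧ a and c ∧ b are disjoint and sum to at least c. Finally, if the side
-- triangle has fixty and {0, a, b, c} is closed under ∗, then the sides are three
-- distinct nonzero members of {a, b, c}, i.e. a rearrangement of the vertices,
-- and fixty is invariant under rearrangement.

module Submission where

open import Defs
open import Data.Product using (_×_; _,_)
open import Data.Sum using (_⊎_; inj₁; inj₂)
open import Function.Bundles using (_⇔_; mk⇔)
open import Relation.Nullary using (contradiction)
open import Relation.Binary.PropositionalEquality
  using (_≡_; _≢_; refl; sym; trans; cong; cong₂; subst; subst₂; isEquivalence)
open import Algebra.Lattice.Bundles using (Lattice)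
import Algebra.Lattice.Properties.Lattice as LatticeProperties
import Relation.Binary.Lattice as Order
import Relation.Binary.Lattice.Properties.JoinSemilattice as JoinSemilatticeProperties
import Relation.Binary.Reasoning.PartialOrder as PartialOrderReasoning

module _ {a} {A : Set a} where

  OneOf : A → A → A → A → Set a
  OneOf x y z w = w ≡ x ⊎ w ≡ y ⊎ w ≡ z

  oneOf-rotate : ∀ {x y z w} → OneOf x y z w → OneOf y z x w
  oneOf-rotate (inj₁ w≡x)        = inj₂ (inj₂ w≡x)
  oneOf-rotate (inj₂ (inj₁ w≡y)) = inj₁ w≡y
  oneOf-rotate (inj₂ (inj₂ w≡z)) = inj₂ (inj₁ w≡z)

  module _ {p} (P : A → A → A → Set p)
           (rotate : ∀ {x y z} → P x y z → P y z x)
           (swap : ∀ {x y z} → P x y z → P y x z) where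

    private
      fromDistinctMembers-anchored : ∀ {x y z b c} → x ≢ y → y ≢ z → z ≢ x →
        OneOf x b c y → OneOf x b c z → P x y z → P x b c
      fromDistinctMembers-anchored x≢y _ _ (inj₁ refl) _ _ = contradiction refl x≢y
      fromDistinctMembers-anchored _ _ z≢x (inj₂ (inj₁ refl)) (inj₁ refl) _ = contradiction refl z≢x
      fromDistinctMembers-anchored _ y≢z _ (inj₂ (inj₁ refl)) (inj₂ (inj₁ refl)) _ = contradiction refl y≢z
      fromDistinctMembers-anchored _ _ _ (inj₂ (inj₁ refl)) (inj₂ (inj₂ refl)) p = p
      fromDistinctMembers-anchored _ _ z≢x (inj₂ (inj₂ refl)) (inj₁ refl) _ = contradiction refl z≢x
      fromDistinctMembers-anchored _ _ _ (inj₂ (inj₂ refl)) (inj₂ (inj₁ refl)) p = rotate (swap p)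
      fromDistinctMembers-anchored _ y≢z _ (inj₂ (inj₂ refl)) (inj₂ (inj₂ refl)) _ = contradiction refl y≢z

    fromDistinctMembers : ∀ {x y z a b c} → x ≢ y → y ≢ z → z ≢ x →
      OneOf a b c x → OneOf a b c y → OneOf a b c z → P x y z → P a b c
    fromDistinctMembers x≢y y≢z z≢x (inj₁ refl) y∈ z∈ p =
      fromDistinctMembers-anchored x≢y y≢z z≢x y∈ z∈ p
    fromDistinctMembers x≢y y≢z z≢x (inj₂ (inj₁ refl)) y∈ z∈ p =
      rotate (rotate (fromDistinctMembers-anchored x≢y y≢z z≢x (oneOf-rotate y∈) (oneOf-rotate z∈) p))
    fromDistinctMembers x≢y y≢z z≢x (inj₂ (inj₂ refl)) y∈ z∈ p =
      rotate (fromDistinctMembers-anchored x≢y y≢z z≢x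
        (oneOf-rotate (oneOf-rotate y∈)) (oneOf-rotate (oneOf-rotate z∈)) p)

module ALMonoidProperties {ℓ} (𝒜 : ALMonoid ℓ) where
  open ALMonoid 𝒜

  -- The library orders an algebraic lattice by x ≡ x ∧ y, the record by the
  -- symmetric equation x ∧ y ≡ x.
  private
    latticeᴬ : Lattice ℓ ℓ
    latticeᴬ = record
      { isLattice = record
        { isEquivalence = isEquivalence
        ; ∨-comm = ∨-comm
        ; ∨-assoc = ∨-assoc
        ; ∨-cong = cong₂ _∨_
        ; ∧-comm = ∧-comm
        ; ∧-assoc = ∧-assoc
        ; ∧-cong = cong₂ _∧_
        ; absorptive = ∨-absorbs-∧ , ∧-absorbs-∨
        }
      }

    module ≼ = Order.IsLattice (LatticeProperties.∨-∧-isOrderTheoreticLattice latticeᴬ)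

  ≤-lattice : Order.Lattice ℓ ℓ ℓ
  ≤-lattice = record
    { isLattice = record
      { isPartialOrder = record
        { isPreorder = record
          { isEquivalence = isEquivalence
          ; reflexive = λ x≡y → sym (≼.reflexive x≡y)
          ; trans = λ x≤y y≤z → sym (≼.trans (sym x≤y) (sym y≤z))
          }
        ; antisym = λ x≤y y≤x → ≼.antisym (sym x≤y) (sym y≤x)
        }
      ; supremum = λ x y →
          sym (≼.x≤x∨y x y) , sym (≼.y≤x∨y x y) , λ _ x≤z y≤z → sym (≼.∨-least (sym x≤z) (sym y≤z))
      ; infimum = λ x y →
          sym (≼.x∧y≤x x y) , sym (≼.x∧y≤y x y) , λ _ z≤x z≤y → sym (≼.∧-greatest (sym z≤x) (sym z≤y))
      }
    }

  open Order.Lattice ≤-lattice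
    using (x≤x∨y; y≤x∨y; ∨-least; x∧y≤x; x∧y≤y; ∧-greatest)
    renaming (refl to ≤-refl; reflexive to ≤-reflexive; trans to ≤-trans; antisym to ≤-antisym)
  open JoinSemilatticeProperties (Order.Lattice.joinSemilattice ≤-lattice) using (x≤y⇒x∨y≈y)
  open PartialOrderReasoning (Order.Lattice.poset ≤-lattice)

  +-identityʳ : ∀ x → x + 0# ≡ x
  +-identityʳ x = trans (+-comm x 0#) (+-identityˡ x)

  +-monoʳ-≤ : ∀ z {x y} → x ≤ y → z + x ≤ z + y
  +-monoʳ-≤ z {x} {y} x≤y = trans (sym (+-distrib-∧ z x y)) (cong (z +_) x≤y)

  +-monoˡ-≤ : ∀ z {x y} → x ≤ y → x + z ≤ y + z
  +-monoˡ-≤ z {x} {y} x≤y = subst₂ _≤_ (+-comm z x) (+-comm z y) (+-monoʳ-≤ z x≤y)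

  +-mono-≤ : ∀ {x y u v} → x ≤ y → u ≤ v → x + u ≤ y + v
  +-mono-≤ {y = y} {u} x≤y u≤v = ≤-trans (+-monoˡ-≤ u x≤y) (+-monoʳ-≤ y u≤v)

  x≤x+y : ∀ {x y} → 0# ≤ y → x ≤ x + y
  x≤x+y {x} {y} 0≤y = subst (_≤ x + y) (+-identityʳ x) (+-monoʳ-≤ x 0≤y)

  x≤y+x : ∀ {x y} → 0# ≤ y → x ≤ y + x
  x≤y+x {x} {y} 0≤y = subst (x ≤_) (+-comm x y) (x≤x+y 0≤y)

  ∨≤+ : ∀ {x y} → 0# ≤ x → 0# ≤ y → x ∨ y ≤ x + y
  ∨≤+ 0≤x 0≤y = ∨-least (x≤x+y 0≤y) (x≤y+x 0≤x)

  ≤-+-∧ : ∀ {x z u v} → x ≤ z + u → x ≤ z + v → x ≤ z + u ∧ v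
  ≤-+-∧ {x} {z} {u} {v} x≤z+u x≤z+v = subst (x ≤_) (sym (+-distrib-∧ z u v)) (∧-greatest x≤z+u x≤z+v)

  ≤-+-disjoint : ∀ {x z u v} → x ≤ z + u → x ≤ z + v → u ∧ v ≡ 0# → x ≤ z
  ≤-+-disjoint {x} {z} x≤z+u x≤z+v u∧v≡0 =
    subst (x ≤_) (trans (cong (z +_) u∧v≡0) (+-identityʳ z)) (≤-+-∧ x≤z+u x≤z+v)

  disjoint⇒+≤∨ : ∀ {x y} → x ∧ y ≡ 0# → x + y ≤ x ∨ y
  disjoint⇒+≤∨ {x} {y} = ≤-+-disjoint
    (subst (_≤ (x ∨ y) + x) (+-comm y x) (+-monoˡ-≤ x (y≤x∨y x y)))
    (+-monoˡ-≤ y (x≤x∨y x y))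

  ≤+⇒≤∧+∧ : ∀ {a b c} → 0# ≤ b → 0# ≤ c ∧ a → c ≤ a + b → c ≤ c ∧ a + c ∧ b
  ≤+⇒≤∧+∧ {a} {b} {c} 0≤b 0≤c∧a c≤a+b = ≤-+-∧ (x≤y+x 0≤c∧a)
    (subst (c ≤_) (+-comm b (c ∧ a)) (≤-+-∧ (x≤y+x 0≤b) (subst (c ≤_) (+-comm a b) c≤a+b)))

  nonneg-≤⇒≡0 : ∀ {x} → 0# ≤ x → x ≤ 0# → x ≡ 0#
  nonneg-≤⇒≡0 0≤x x≤0 = ≤-antisym x≤0 0≤x

  y≤x⇒x*y+y≡x : ∀ {x y} → y ≤ x → x * y + y ≡ x
  y≤x⇒x*y+y≡x {x} {y} y≤x = begin-equality
    x * y + y        ≡⟨ cong (λ w → x * w + y) (trans (∧-comm x y) y≤x) ⟨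
    x * (x ∧ y) + y  ≡⟨ ax2 x y ⟩
    x ∨ y            ≡⟨ ∨-comm x y ⟩
    y ∨ x            ≡⟨ x≤y⇒x∨y≈y y≤x ⟩
    x                ∎

  y≤x⇒x*y≤x : ∀ {x y} → 0# ≤ y → y ≤ x → x * y ≤ x
  y≤x⇒x*y≤x 0≤y y≤x = subst (_ ≤_) (y≤x⇒x*y+y≡x y≤x) (x≤x+y 0≤y)

  x*0≡x : ∀ {x} → 0# ≤ x → x * 0# ≡ x
  x*0≡x {x} 0≤x = trans (sym (+-identityʳ (x * 0#))) (y≤x⇒x*y+y≡x 0≤x)

  0*x≡x : ∀ {x} → 0# ≤ x → 0# * x ≡ x
  0*x≡x {x} 0≤x = trans (*-comm 0# x) (x*0≡x 0≤x)

  *-≢0 : ∀ {x y} → x ≢ y → x * y ≢ 0#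
  *-≢0 {x} {y} x≢y xy≡0 = x≢y (*-zero⇒≡ x y xy≡0)

  *-mono-chain : ∀ {x y z} → z ≤ x → x ≤ y → x * z ≤ y * z
  *-mono-chain {x} {y} {z} z≤x x≤y =
    subst (_≤ y * z) (cong₂ _*_ x≤y (trans (∧-comm x z) z≤x)) (contr-∧ x y z)

  x*y≤*∧+*∧ : ∀ x y → x * y ≤ x * (x ∧ y) + y * (x ∧ y)
  x*y≤*∧+*∧ x y = subst (x * y ≤_) (cong (x * (x ∧ y) +_) (*-comm (x ∧ y) y)) (*-triangle x y (x ∧ y))

  x*y≤x∨y : ∀ {x y} → 0# ≤ x → 0# ≤ y → x * y ≤ x ∨ y
  x*y≤x∨y {x} {y} 0≤x 0≤y = begin
    x * y                      ≤⟨ x*y≤*∧+*∧ x y ⟩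
    x * (x ∧ y) + y * (x ∧ y)  ≤⟨ +-monoʳ-≤ _ (y≤x⇒x*y≤x (∧-greatest 0≤x 0≤y) (x∧y≤y x y)) ⟩
    x * (x ∧ y) + y            ≡⟨ ax2 x y ⟩
    x ∨ y                      ∎

  *∧≤*∨ : ∀ x y → x * (x ∧ y) ≤ y * (x ∨ y)
  *∧≤*∨ x y = subst (_≤ y * (x ∨ y))
    (trans (cong ((x ∧ y) *_) (∧-absorbs-∨ x y)) (*-comm (x ∧ y) x)) (contr-∧ x y (x ∨ y))

  *∧≤*∨′ : ∀ x y → y * (x ∧ y) ≤ x * (x ∨ y)
  *∧≤*∨′ x y = subst₂ _≤_ (cong (y *_) (∧-comm y x)) (cong (x *_) (∨-comm y x)) (*∧≤*∨ y x)

  *∧-disjoint : ∀ x y → x * (x ∧ y) ∧ y * (x ∧ y) ≡ 0#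
  *∧-disjoint x y = nonneg-≤⇒≡0 (∧-greatest (*-nonneg x _) (*-nonneg y _)) (begin
    x * (x ∧ y) ∧ y * (x ∧ y)  ≤⟨ ∧-greatest (≤-trans (x∧y≤y _ _) (*∧≤*∨′ x y)) (≤-trans (x∧y≤x _ _) (*∧≤*∨ x y)) ⟩
    x * (x ∨ y) ∧ y * (x ∨ y)  ≡⟨ ax4 x y ⟩
    0#                         ∎)

  x*y≤*∨+*∨ : ∀ x y → x * y ≤ x * (x ∨ y) + y * (x ∨ y)
  x*y≤*∨+*∨ x y = begin
    x * y                      ≤⟨ x*y≤*∧+*∧ x y ⟩
    x * (x ∧ y) + y * (x ∧ y)  ≤⟨ +-mono-≤ (*∧≤*∨ x y) (*∧≤*∨′ x y) ⟩
    y * (x ∨ y) + x * (x ∨ y)  ≡⟨ +-comm _ _ ⟩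
    x * (x ∨ y) + y * (x ∨ y)  ∎

  ∨≤+∧⇒*≤ : ∀ {a b c} → 0# ≤ c → a ∨ b ≤ c + a ∧ b → a * b ≤ c
  ∨≤+∧⇒*≤ {a} {b} {c} 0≤c a∨b≤c+a∧b = begin
    a * b                      ≤⟨ x*y≤*∧+*∧ a b ⟩
    a * (a ∧ b) + b * (a ∧ b)  ≤⟨ disjoint⇒+≤∨ (*∧-disjoint a b) ⟩
    a * (a ∧ b) ∨ b * (a ∧ b)  ≤⟨ ∨-least (*-mono-chain (x∧y≤x a b) (x≤x∨y a b))
                                           (*-mono-chain (x∧y≤y a b) (y≤x∨y a b)) ⟩
    (a ∨ b) * (a ∧ b)          ≤⟨ *-mono-chain (≤-trans (x∧y≤x a b) (x≤x∨y a b)) a∨b≤c+a∧b ⟩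
    (c + a ∧ b) * (a ∧ b)      ≡⟨ cong₂ _*_ (+-comm c _) (sym (+-identityʳ _)) ⟩
    (a ∧ b + c) * (a ∧ b + 0#) ≤⟨ contr-+ (a ∧ b) c 0# ⟩
    c * 0#                     ≡⟨ x*0≡x 0≤c ⟩
    c                          ∎

  disjoint⇒∨≤* : ∀ {x y} → 0# ≤ x → 0# ≤ y → x ∧ y ≡ 0# → x ∨ y ≤ x * y
  disjoint⇒∨≤* {x} {y} 0≤x 0≤y x∧y≡0 = ∨-least
    (subst (_≤ x * y) (trans (cong₂ _*_ ≤-refl x∧y≡0) (x*0≡x 0≤x)) (contr-∧ x x y))
    (subst (_≤ x * y) (trans (cong₂ _*_ (trans (∧-comm y x) x∧y≡0) ≤-refl) (0*x≡x 0≤y)) (contr-∧ y x y))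

  ≤+⇒≤* : ∀ {a b c} → 0# ≤ a → 0# ≤ b → 0# ≤ c → a ∧ b ∧ c ≡ 0# → c ≤ a + b → c ≤ a * b
  ≤+⇒≤* {a} {b} {c} 0≤a 0≤b 0≤c a∧b∧c≡0 c≤a+b = begin
    c                          ≤⟨ ≤+⇒≤∧+∧ 0≤b 0≤c∧a c≤a+b ⟩
    c ∧ a + c ∧ b              ≤⟨ disjoint⇒+≤∨ disjoint ⟩
    (c ∧ a) ∨ (c ∧ b)          ≤⟨ disjoint⇒∨≤* 0≤c∧a (∧-greatest 0≤c 0≤b) disjoint ⟩
    (c ∧ a) * (c ∧ b)          ≤⟨ contr-∧ c a b ⟩
    a * b                      ∎
    where
    0≤c∧a : 0# ≤ c ∧ a
    0≤c∧a = ∧-greatest 0≤c 0≤a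

    disjoint : c ∧ a ∧ (c ∧ b) ≡ 0#
    disjoint = nonneg-≤⇒≡0 (∧-greatest 0≤c∧a (∧-greatest 0≤c 0≤b)) (begin
      c ∧ a ∧ (c ∧ b)  ≤⟨ ∧-greatest (∧-greatest (≤-trans (x∧y≤x _ _) (x∧y≤y _ _))
                                                  (≤-trans (x∧y≤y _ _) (x∧y≤y _ _)))
                                     (≤-trans (x∧y≤x _ _) (x∧y≤x _ _)) ⟩
      a ∧ b ∧ c        ≡⟨ a∧b∧c≡0 ⟩
      0#               ∎)

  SharedJoinZeroMeet : Carrier → Carrier → Carrier → Set ℓ
  SharedJoinZeroMeet a b c = (a ∨ b ≡ b ∨ c) × (b ∨ c ≡ c ∨ a) × (a ∧ b ∧ c ≡ 0#)

  sharedJoinZeroMeet-rotate : ∀ {a b c} → SharedJoinZeroMeet a b c → SharedJoinZeroMeet b c a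
  sharedJoinZeroMeet-rotate {a} {b} {c} (ab≡bc , bc≡ca , abc≡0) =
    bc≡ca , sym (trans ab≡bc bc≡ca) , trans (∧-comm (b ∧ c) a) (trans (sym (∧-assoc a b c)) abc≡0)

  fixty-rotate : ∀ {a b c} → HasFixty a b c → HasFixty b c a
  fixty-rotate (ab , bc , ca) = bc , ca , ab

  fixty-swap : ∀ {a b c} → HasFixty a b c → HasFixty b a c
  fixty-swap {a} {b} {c} (ab , bc , ca) =
    trans (*-comm b a) ab , trans (*-comm a c) ca , trans (*-comm c b) bc

  fixty⇒0≤ : ∀ {a b c} → HasFixty a b c → 0# ≤ c
  fixty⇒0≤ (ab , _ , _) = subst (0# ≤_) ab (*-nonneg _ _)

  fixty⇒≤∨ : ∀ {a b c} → HasFixty a b c → c ≤ a ∨ b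
  fixty⇒≤∨ h@(ab , _ , _) =
    subst (_≤ _) ab (x*y≤x∨y (fixty⇒0≤ (fixty-rotate h)) (fixty⇒0≤ (fixty-rotate (fixty-rotate h))))

  fixty⇒≢ : ∀ {x y z} → HasFixty x y z → z ≢ 0# → x ≢ y
  fixty⇒≢ (xx≡z , _ , _) z≢0 refl = z≢0 (trans (sym xx≡z) (*-self _))

  ≤∨-cycle⇒≡ : ∀ {a b c} → a ≤ b ∨ c → c ≤ a ∨ b → a ∨ b ≡ b ∨ c
  ≤∨-cycle⇒≡ {a} {b} {c} a≤b∨c c≤a∨b =
    ≤-antisym (∨-least a≤b∨c (x≤x∨y b c)) (∨-least (y≤x∨y a b) c≤a∨b)

  fixty⇒zeroMeet : ∀ {a b c} → HasFixty a b c → a ∨ b ≡ b ∨ c → b ∨ c ≡ c ∨ a → a ∧ b ∧ c ≡ 0#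
  fixty⇒zeroMeet {a} {b} {c} h@(ab , bc , ca) ab≡bc bc≡ca =
    nonneg-≤⇒≡0 0≤t (subst (t ≤_) (ax4 a b) (∧-greatest t≤a*m t≤b*m))
    where
    m : Carrier
    m = a ∨ b
    t : Carrier
    t = a ∧ b ∧ c

    vertex≤ : ∀ {x y z} → x * y ≡ z → x ∨ y ≡ m → z ≤ x * m + y * m
    vertex≤ {x} {y} xy≡z x∨y≡m = subst₂ (λ w v → w ≤ x * v + y * v) xy≡z x∨y≡m (x*y≤*∨+*∨ x y)

    disjoint : ∀ {x y} → x ∨ y ≡ m → x * m ∧ y * m ≡ 0#
    disjoint {x} {y} x∨y≡m = subst (λ v → x * v ∧ y * v ≡ 0#) x∨y≡m (ax4 x y)

    c≤ : c ≤ a * m + b * m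
    c≤ = vertex≤ ab refl
    a≤ : a ≤ b * m + c * m
    a≤ = vertex≤ bc (sym ab≡bc)
    b≤ : b ≤ c * m + a * m
    b≤ = vertex≤ ca (sym (trans ab≡bc bc≡ca))

    t≤a : t ≤ a
    t≤a = ≤-trans (x∧y≤x _ _) (x∧y≤x a b)
    t≤b : t ≤ b
    t≤b = ≤-trans (x∧y≤x _ _) (x∧y≤y a b)
    t≤c : t ≤ c
    t≤c = x∧y≤y _ _

    t≤a*m : t ≤ a * m
    t≤a*m = ≤-+-disjoint (≤-trans t≤c c≤) (≤-trans t≤b (subst (b ≤_) (+-comm _ _) b≤))
      (disjoint (sym ab≡bc))
    t≤b*m : t ≤ b * m
    t≤b*m = ≤-+-disjoint (≤-trans t≤c (subst (c ≤_) (+-comm _ _) c≤)) (≤-trans t≤a a≤)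
      (trans (∧-comm _ _) (disjoint (sym (trans ab≡bc bc≡ca))))

    0≤t : 0# ≤ t
    0≤t = ∧-greatest (∧-greatest (fixty⇒0≤ (fixty-rotate h)) (fixty⇒0≤ (fixty-rotate (fixty-rotate h))))
                     (fixty⇒0≤ h)

  fixty⇒sharedJoinZeroMeet : ∀ {a b c} → HasFixty a b c → SharedJoinZeroMeet a b c
  fixty⇒sharedJoinZeroMeet {a} {b} {c} h = ab≡bc , bc≡ca , fixty⇒zeroMeet h ab≡bc bc≡ca
    where
    h′ : HasFixty b c a
    h′ = fixty-rotate h
    ab≡bc : a ∨ b ≡ b ∨ c
    ab≡bc = ≤∨-cycle⇒≡ (fixty⇒≤∨ h′) (fixty⇒≤∨ h)
    bc≡ca : b ∨ c ≡ c ∨ a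
    bc≡ca = ≤∨-cycle⇒≡ (fixty⇒≤∨ (fixty-rotate h′)) (fixty⇒≤∨ h′)

  sharedJoinZeroMeet⇒*≡ : ∀ {a b c} → SharedJoinZeroMeet a b c → a * b ≡ c
  sharedJoinZeroMeet⇒*≡ {a} {b} {c} (ab≡bc , bc≡ca , abc≡0) = ≤-antisym
    (∨≤+∧⇒*≤ 0≤c (≤-+-∧ (subst (_≤ c + a) (sym ab≡ca) (∨≤+ 0≤c 0≤a))
                        (subst₂ _≤_ (sym ab≡bc) (+-comm b c) (∨≤+ 0≤b 0≤c))))
    (≤+⇒≤* 0≤a 0≤b 0≤c abc≡0
      (≤-trans (subst (c ≤_) (sym ab≡bc) (y≤x∨y b c)) (∨≤+ 0≤a 0≤b)))
    where
    ab≡ca : a ∨ b ≡ c ∨ a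
    ab≡ca = trans ab≡bc bc≡ca
    0≤abc : 0# ≤ a ∧ b ∧ c
    0≤abc = ≤-reflexive (sym abc≡0)
    0≤a : 0# ≤ a
    0≤a = ≤-trans 0≤abc (≤-trans (x∧y≤x _ _) (x∧y≤x a b))
    0≤b : 0# ≤ b
    0≤b = ≤-trans 0≤abc (≤-trans (x∧y≤x _ _) (x∧y≤y a b))
    0≤c : 0# ≤ c
    0≤c = ≤-trans 0≤abc (x∧y≤y _ _)

  sharedJoinZeroMeet⇒fixty : ∀ {a b c} → SharedJoinZeroMeet a b c → HasFixty a b c
  sharedJoinZeroMeet⇒fixty {a} {b} {c} h =
    sharedJoinZeroMeet⇒*≡ h , sharedJoinZeroMeet⇒*≡ h′ , sharedJoinZeroMeet⇒*≡ (sharedJoinZeroMeet-rotate h′)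
    where
    h′ : SharedJoinZeroMeet b c a
    h′ = sharedJoinZeroMeet-rotate h

  fixty⇒sides-fixty : ∀ {a b c} → HasFixty a b c → HasFixty (a * b) (b * c) (c * a)
  fixty⇒sides-fixty (ab , bc , ca) = cong₂ _*_ ab bc , cong₂ _*_ bc ca , cong₂ _*_ ca ab

  fixty⇒member-nonneg : ∀ {a b c x} → HasFixty a b c → Set0abc a b c x → 0# ≤ x
  fixty⇒member-nonneg _ (inj₁ refl)                 = ≤-refl
  fixty⇒member-nonneg h (inj₂ (inj₁ refl))          = fixty⇒0≤ (fixty-rotate h)
  fixty⇒member-nonneg h (inj₂ (inj₂ (inj₁ refl)))   = fixty⇒0≤ (fixty-rotate (fixty-rotate h))
  fixty⇒member-nonneg h (inj₂ (inj₂ (inj₂ refl)))   = fixty⇒0≤ h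

  fixty⇒oneOf-closed : ∀ {a b c x y} → HasFixty a b c →
    OneOf a b c x → OneOf a b c y → Set0abc a b c (x * y)
  fixty⇒oneOf-closed {a} _ (inj₁ refl) (inj₁ refl) = inj₁ (*-self a)
  fixty⇒oneOf-closed (ab , _ , _) (inj₁ refl) (inj₂ (inj₁ refl)) = inj₂ (inj₂ (inj₂ ab))
  fixty⇒oneOf-closed {a} {c = c} (_ , _ , ca) (inj₁ refl) (inj₂ (inj₂ refl)) =
    inj₂ (inj₂ (inj₁ (trans (*-comm a c) ca)))
  fixty⇒oneOf-closed {a} {b} (ab , _ , _) (inj₂ (inj₁ refl)) (inj₁ refl) =
    inj₂ (inj₂ (inj₂ (trans (*-comm b a) ab)))
  fixty⇒oneOf-closed {b = b} _ (inj₂ (inj₁ refl)) (inj₂ (inj₁ refl)) = inj₁ (*-self b)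
  fixty⇒oneOf-closed (_ , bc , _) (inj₂ (inj₁ refl)) (inj₂ (inj₂ refl)) = inj₂ (inj₁ bc)
  fixty⇒oneOf-closed (_ , _ , ca) (inj₂ (inj₂ refl)) (inj₁ refl) = inj₂ (inj₂ (inj₁ ca))
  fixty⇒oneOf-closed {b = b} {c} (_ , bc , _) (inj₂ (inj₂ refl)) (inj₂ (inj₁ refl)) =
    inj₂ (inj₁ (trans (*-comm c b) bc))
  fixty⇒oneOf-closed {c = c} _ (inj₂ (inj₂ refl)) (inj₂ (inj₂ refl)) = inj₁ (*-self c)

  fixty⇒subgeometry : ∀ {a b c} → HasFixty a b c → IsSubgeometry (Set0abc a b c)
  fixty⇒subgeometry {a} {b} {c} h _ _ (inj₁ refl) y∈ =
    subst (Set0abc a b c) (sym (0*x≡x (fixty⇒member-nonneg h y∈))) y∈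
  fixty⇒subgeometry {a} {b} {c} h _ _ x∈@(inj₂ _) (inj₁ refl) =
    subst (Set0abc a b c) (sym (x*0≡x (fixty⇒member-nonneg h x∈))) x∈
  fixty⇒subgeometry h _ _ (inj₂ x∈) (inj₂ y∈) = fixty⇒oneOf-closed h x∈ y∈

  nonzero-member : ∀ {a b c x} → Set0abc a b c x → x ≢ 0# → OneOf a b c x
  nonzero-member (inj₁ x≡0) x≢0 = contradiction x≡0 x≢0
  nonzero-member (inj₂ x∈) _    = x∈

  sides-fixty⇒fixty : ∀ {a b c} → a ≢ b → b ≢ c → c ≢ a →
    HasFixty (a * b) (b * c) (c * a) → IsSubgeometry (Set0abc a b c) → HasFixty a b c
  sides-fixty⇒fixty {a} {b} {c} a≢b b≢c c≢a h closed =
    fromDistinctMembers HasFixty fixty-rotate fixty-swap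
      (fixty⇒≢ h ca≢0) (fixty⇒≢ (fixty-rotate h) ab≢0) (fixty⇒≢ (fixty-rotate (fixty-rotate h)) bc≢0)
      (nonzero-member (closed a b a∈ b∈) ab≢0)
      (nonzero-member (closed b c b∈ c∈) bc≢0)
      (nonzero-member (closed c a c∈ a∈) ca≢0)
      h
    where
    ab≢0 : a * b ≢ 0#
    ab≢0 = *-≢0 a≢b
    bc≢0 : b * c ≢ 0#
    bc≢0 = *-≢0 b≢c
    ca≢0 : c * a ≢ 0#
    ca≢0 = *-≢0 c≢a
    a∈ : Set0abc a b c a
    a∈ = inj₂ (inj₁ refl)
    b∈ : Set0abc a b c b
    b∈ = inj₂ (inj₂ (inj₁ refl))
    c∈ : Set0abc a b c c
    c∈ = inj₂ (inj₂ (inj₂ refl))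

mainTheorem1 : ∀ {ℓ} (A : ALMonoid ℓ) → let open ALMonoid A in
    ∀ (a b c : Carrier) → a ≢ b → b ≢ c → c ≢ a →
      (HasFixty a b c ⇔ ((a ∨ b ≡ b ∨ c) × (b ∨ c ≡ c ∨ a) × (a ∧ b ∧ c ≡ 0#)))
    × (((a ∨ b ≡ b ∨ c) × (b ∨ c ≡ c ∨ a) × (a ∧ b ∧ c ≡ 0#))
        ⇔ (HasFixty (a * b) (b * c) (c * a) × IsSubgeometry (Set0abc a b c)))
mainTheorem1 A a b c a≢b b≢c c≢a =
    mk⇔ fixty⇒sharedJoinZeroMeet sharedJoinZeroMeet⇒fixty
  , mk⇔ (λ h → let fixty = sharedJoinZeroMeet⇒fixty h in
                 fixty⇒sides-fixty fixty , fixty⇒subgeometry fixty)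
        (λ (sides-fixty , closed) →
          fixty⇒sharedJoinZeroMeet (sides-fixty⇒fixty a≢b b≢c c≢a sides-fixty closed))
  where open ALMonoidProperties A
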